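{- Let $M = \langle W, \mathcal{N}, \leq, V \rangle$ be a PN-model. Then for every formula $\varphi$ and all $w, v \in W$: if $w \Vdash \varphi$ and $w \leq v$, then $v \Vdash \varphi$.
   Context: Formulas are built from a fixed denumerable set $PV$ of propositional variables and the constant $\bot$ using the binary connectives $\land, \lor, \rightarrow$ and the unary operator $\Box$ ($\lnot\varphi$ abbreviates $\varphi \rightarrow \bot$). A PN-frame is a triple $\langle W, \mathcal{N}, \leq \rangle$ where $\leq$ is a partial order on the set $W$ and $\mathcal{N}: W \to P(P(W))$ (write $\mathcal{N}_w$ for $\mathcal{N}(w)$) satisfies: whenever $w \leq v$, $v \in X \subseteq W$ and $X \in \mathcal{N}_w$, then $X \in \mathcal{N}_v$. A PN-model is $\langle W, \mathcal{N}, \leq, V \rangle$ where $\langle W, \mathcal{N}, \leq \rangle$ is a PN-frame and $V: PV \to P(W)$ satisfies: if $w \in V(q)$ and $w \leq v$ then $v \in V(q)$. Forcing is defined inductively: $w \nVdash \bot$; $w \Vdash q$ iff $w \in V(q)$; $w \Vdash \varphi \lor \psi$ iff $w \Vdash \varphi$ or $w \Vdash \psi$; $w \Vdash \varphi \land \psi$ iff $w \Vdash \varphi$ and $w \Vdash \psi$; $w \Vdash \varphi \rightarrow \psi$ iff for every $v \in W$ with $w \leq v$, $v \nVdash \varphi$ or $v \Vdash \psi$; $w \Vdash \Box \varphi$ iff $w \Vdash \varphi$ and $\{z \in W : z \Vdash \varphi\} \in \mathcal{N}_w$. -}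

module Defs where

open import Data.Nat using (ℕ)
open import Data.Empty using (⊥)
open import Data.Product using (_×_)
open import Data.Sum using (_⊎_)
open import Relation.Binary.Bundles using (Poset)
open import Level using (0ℓ)

PV : Set
PV = ℕ

data Formula : Set where
  var  : PV → Formula
  ⊥̇    : Formula
  _∧̇_  : Formula → Formula → Formula
  _∨̇_  : Formula → Formula → Formula
  _⇒_  : Formula → Formula → Formula
  □_   : Formula → Formula

-- Subsets of W are represented as predicates W → Set.
record PNFrame : Set₁ where
  field
    poset : Poset 0ℓ 0ℓ 0ℓ
  open Poset poset public renaming (Carrier to W)
  field
    𝒩 : W → (W → Set) → Set
    𝒩-mono : ∀ {w v} (X : W → Set) → w ≤ v → X v → 𝒩 w X → 𝒩 v X

record PNModel : Set₁ where
  field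
    frame : PNFrame
  open PNFrame frame public
  field
    V : PV → W → Set
    V-mono : ∀ (q : PV) {w v} → V q w → w ≤ v → V q v

module _ (M : PNModel) where
  open PNModel M

  _⊩_ : W → Formula → Set
  w ⊩ var q   = V q w
  w ⊩ ⊥̇       = ⊥
  w ⊩ (φ ∧̇ ψ) = (w ⊩ φ) × (w ⊩ ψ)
  w ⊩ (φ ∨̇ ψ) = (w ⊩ φ) ⊎ (w ⊩ ψ)
  w ⊩ (φ ⇒ ψ) = ∀ v → w ≤ v → v ⊩ φ → v ⊩ ψ
  w ⊩ (□ φ)   = (w ⊩ φ) × 𝒩 w (λ z → z ⊩ φ)

module Submission where

open import Defs
open import Data.Product using (_,_)
open import Data.Sum using (inj₁; inj₂)

module _ (M : PNModel) where
  open PNModel M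

  ⊩-mono : ∀ φ {w v} → _⊩_ M w φ → w ≤ v → _⊩_ M v φ
  ⊩-mono (var q)   w⊩q         w≤v = V-mono q w⊩q w≤v
  ⊩-mono ⊥̇         ()          w≤v
  ⊩-mono (φ ∧̇ ψ)   (w⊩φ , w⊩ψ) w≤v = ⊩-mono φ w⊩φ w≤v , ⊩-mono ψ w⊩ψ w≤v
  ⊩-mono (φ ∨̇ ψ)   (inj₁ w⊩φ)  w≤v = inj₁ (⊩-mono φ w⊩φ w≤v)
  ⊩-mono (φ ∨̇ ψ)   (inj₂ w⊩ψ)  w≤v = inj₂ (⊩-mono ψ w⊩ψ w≤v)
  ⊩-mono (φ ⇒ ψ)   w⊩φ⇒ψ       w≤v = λ u v≤u → w⊩φ⇒ψ u (trans w≤v v≤u)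
  -- 𝒩-mono needs v in the truth set of φ, which the induction hypothesis supplies.
  ⊩-mono (□ φ)     (w⊩φ , 𝒩w)  w≤v = v⊩φ , 𝒩-mono (λ z → _⊩_ M z φ) w≤v v⊩φ 𝒩w
    where v⊩φ = ⊩-mono φ w⊩φ w≤v

mainTheorem1 : (M : PNModel) (φ : Formula) (w v : PNModel.W M) →
    _⊩_ M w φ → PNModel._≤_ M w v → _⊩_ M v φ
mainTheorem1 M φ w v = ⊩-mono M φ
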